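{- Let $k\ge 3$ and let $n$ be a positive integer. If $a,b,c,d,e$ are natural numbers with $n^3\le a<b<c<d<e$ such that the set $\{a,b,c,d,e\}$ has property $D_k(-n)$, then $e\geq b^{k-1}$.
   Context: A set of natural numbers $S$ has property $D_k(N)$ (for a non-zero integer $N$) if $xy+N$ is a perfect $k$-th power for all distinct $x,y\in S$. Here $N=-n$, i.e. $xy-n$ is a perfect $k$-th power for all distinct $x,y\in S$. -}

module Defs where

open import Data.Nat using (ℕ)
open import Data.Integer using (ℤ; +_; _-_; _*_; _^_)
open import Data.Product using (∃)
open import Data.List using (List)
open import Data.List.Membership.Propositional using (_∈_)
open import Relation.Binary.PropositionalEquality using (_≡_)
open import Relation.Nullary using (¬_)

IsPerfectPower : ℕ → ℤ → Set
IsPerfectPower k m = ∃ λ (z : ℤ) → z ^ k ≡ m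

HasD : ℕ → ℤ → List ℕ → Set
HasD k N S = ∀ x y → x ∈ S → y ∈ S → ¬ (x ≡ y) →
  IsPerfectPower k ((+ x) * (+ y) Data.Integer.+ N)

module Submission where

-- If xy − n is a k-th power for the four pairs (c,d), (b,e), (c,e), (b,d), put
-- X = (cd−n)^{1/k} (be−n)^{1/k} and Y = (ce−n)^{1/k} (bd−n)^{1/k}.  The identity
-- (cd−n)(be−n) − (ce−n)(bd−n) = n(c−b)(e−d) gives X^k − Y^k = n(c−b)(e−d) > 0, so
-- X^{k−1} ≤ X^k − Y^k < nce.  On the other hand X^k ≥ c²be once b ≥ 2n.  Comparing,
-- (c²be)^{k−1} < (nce)^k, i.e. c^{k−2} b^{k−1} < n^k e, and n^k ≤ c^{k−2} because
-- n³ ≤ c and k ≥ 3.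

open import Defs
open import Data.Nat using (ℕ; _≤_; _<_; _^_; _∸_)
open import Data.Integer using (-_; +_)
open import Data.List using (_∷_; [])

open import Data.Nat using (zero; suc; _+_; _*_; z≤n; s≤s; NonZero; >-nonZero; >-nonZero⁻¹)
open import Data.Nat.Properties
open import Data.Nat.Tactic.RingSolver using (solve-∀)
open import Data.Integer as ℤ using (∣_∣)
import Data.Integer.Properties as ℤ
open import Data.List using (List)
open import Data.Product using (∃; _,_)
open import Data.List.Membership.Propositional using (_∈_)
open import Data.List.Relation.Unary.Any using (here; there)
open import Relation.Binary.PropositionalEquality
open import Relation.Nullary using (yes; no; contradiction)

^-distrib-* : ∀ x y m → (x * y) ^ m ≡ x ^ m * y ^ m
^-distrib-* x y zero    = refl
^-distrib-* x y (suc m) = begin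
  x * y * (x * y) ^ m     ≡⟨ cong (x * y *_) (^-distrib-* x y m) ⟩
  x * y * (x ^ m * y ^ m) ≡⟨ interchange x y (x ^ m) (y ^ m) ⟩
  x * x ^ m * (y * y ^ m) ∎
  where
  open ≡-Reasoning
  interchange : ∀ x y x′ y′ → x * y * (x′ * y′) ≡ x * x′ * (y * y′)
  interchange = solve-∀

^-comm-exponents : ∀ x m n → (x ^ m) ^ n ≡ (x ^ n) ^ m
^-comm-exponents x m n = begin
  (x ^ m) ^ n ≡⟨ ^-*-assoc x m n ⟩
  x ^ (m * n) ≡⟨ cong (x ^_) (*-comm m n) ⟩
  x ^ (n * m) ≡⟨ ^-*-assoc x n m ⟨
  (x ^ n) ^ m ∎
  where open ≡-Reasoning

∣i^n∣≡∣i∣^n : ∀ i n → ∣ i ℤ.^ n ∣ ≡ ∣ i ∣ ^ n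
∣i^n∣≡∣i∣^n i zero    = refl
∣i^n∣≡∣i∣^n i (suc n) = trans (ℤ.abs-* i (i ℤ.^ n)) (cong (∣ i ∣ *_) (∣i^n∣≡∣i∣^n i n))

^-suc-gap : ∀ {x y} m → y < x → x ^ m + y ^ suc m ≤ x ^ suc m
^-suc-gap {suc x′} {y} m (s≤s y≤x′) = begin
  x ^ m + y ^ suc m    ≤⟨ +-monoʳ-≤ (x ^ m) (^-monoˡ-≤ (suc m) y≤x′) ⟩
  x ^ m + x′ * x′ ^ m  ≤⟨ +-monoʳ-≤ (x ^ m) (*-monoʳ-≤ x′ (^-monoˡ-≤ m (n≤1+n x′))) ⟩
  x ^ m + x′ * x ^ m   ∎
  where
  open ≤-Reasoning
  x = suc x′

^-pred≤difference : ∀ {x y r} m → x ^ suc m ≡ y ^ suc m + r → 0 < r → x ^ m ≤ r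
^-pred≤difference {x} {y} {r} m eq r>0 = +-cancelˡ-≤ (y ^ suc m) _ _ (begin
  y ^ suc m + x ^ m ≡⟨ +-comm (y ^ suc m) (x ^ m) ⟩
  x ^ m + y ^ suc m ≤⟨ ^-suc-gap m y<x ⟩
  x ^ suc m         ≡⟨ eq ⟩
  y ^ suc m + r     ∎)
  where
  open ≤-Reasoning
  y<x : y < x
  y<x with x ≤? y
  ... | no  x≰y = ≰⇒> x≰y
  ... | yes x≤y = contradiction (≤-trans (≤-reflexive (sym eq)) (^-monoˡ-≤ (suc m) x≤y))
                                (<⇒≱ (m<m+n (y ^ suc m) r>0))

-- x − n is a perfect k-th power, stated additively to avoid truncated subtraction.
IsPowerPlus : ℕ → ℕ → ℕ → Set
IsPowerPlus k n x = ∃ λ t → t ^ k + n ≡ x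

perfectPower⇒IsPowerPlus : ∀ {k n x y} → n ≤ x * y →
  IsPerfectPower k (+ x ℤ.* + y ℤ.+ - + n) → IsPowerPlus k n (x * y)
perfectPower⇒IsPowerPlus {k} {n} {x} {y} n≤xy (z , zᵏ≡xy-n) = ∣ z ∣ , (begin
  ∣ z ∣ ^ k + n                 ≡⟨ cong (_+ n) (∣i^n∣≡∣i∣^n z k) ⟨
  ∣ z ℤ.^ k ∣ + n               ≡⟨ cong (λ i → ∣ i ∣ + n) zᵏ≡xy-n ⟩
  ∣ + x ℤ.* + y ℤ.+ - + n ∣ + n ≡⟨ cong (λ i → ∣ i ℤ.+ - + n ∣ + n) (ℤ.pos-* x y) ⟨
  ∣ + (x * y) ℤ.+ - + n ∣ + n   ≡⟨ cong (λ i → ∣ i ∣ + n) (ℤ.m-n≡m⊖n (x * y) n) ⟩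
  ∣ x * y ℤ.⊖ n ∣ + n           ≡⟨ cong (λ i → ∣ i ∣ + n) (ℤ.⊖-≥ n≤xy) ⟩
  x * y ∸ n + n                 ≡⟨ m∸n+n≡m n≤xy ⟩
  x * y                         ∎)
  where open ≡-Reasoning

HasD⇒IsPowerPlus : ∀ {k n S x y} → HasD k (- + n) S → x ∈ S → y ∈ S → n ≤ x → x < y →
  IsPowerPlus k n (x * y)
HasD⇒IsPowerPlus {k} {n} {S} {x} {y} D x∈S y∈S n≤x x<y =
  perfectPower⇒IsPowerPlus {k} {n} {x} {y} n≤xy (D x y x∈S y∈S (<⇒≢ x<y))
  where
  n≤xy : n ≤ x * y
  n≤xy = ≤-trans n≤x (m≤m*n x y {{>-nonZero (≤-trans (s≤s z≤n) x<y)}})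
expand-shifted-product : ∀ u v n → (u + n) * (v + n) ≡ n * (u + v + n) + u * v
expand-shifted-product = solve-∀

shifted-product-difference : ∀ {u v w z n r} →
  (u + n) * (v + n) ≡ (w + n) * (z + n) → w + z ≡ u + v + r → u * v ≡ w * z + n * r
shifted-product-difference {u} {v} {w} {z} {n} {r} products sums =
  +-cancelˡ-≡ (n * (u + v + n)) _ _ (begin
    n * (u + v + n) + u * v           ≡⟨ expand-shifted-product u v n ⟨
    (u + n) * (v + n)                 ≡⟨ products ⟩
    (w + n) * (z + n)                 ≡⟨ expand-shifted-product w z n ⟩
    n * (w + z + n) + w * z           ≡⟨ cong (λ s → n * (s + n) + w * z) sums ⟩
    n * (u + v + r + n) + w * z       ≡⟨ regroup u v w z n r ⟩
    n * (u + v + n) + (w * z + n * r) ∎)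
  where
  open ≡-Reasoning
  regroup : ∀ u v w z n r → n * (u + v + r + n) + w * z ≡ n * (u + v + n) + (w * z + n * r)
  regroup = solve-∀

cross-difference : ∀ {n b c d e p q u v w z} → b + p ≡ c → d + q ≡ e →
  u + n ≡ c * d → v + n ≡ b * e → w + n ≡ c * e → z + n ≡ b * d →
  u * v ≡ w * z + n * (p * q)
cross-difference {n} {b} {d = d} {p = p} {q} {u} {v} {w} {z} refl refl hu hv hw hz =
  shifted-product-difference {u} {v} {w} {z} {n} {p * q} products sums
  where
  open ≡-Reasoning
  products : (u + n) * (v + n) ≡ (w + n) * (z + n)
  products = begin
    (u + n) * (v + n)             ≡⟨ cong₂ _*_ hu hv ⟩
    (b + p) * d * (b * (d + q))   ≡⟨ swap b p d q ⟩
    (b + p) * (d + q) * (b * d)   ≡⟨ cong₂ _*_ hw hz ⟨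
    (w + n) * (z + n)             ∎
    where
    swap : ∀ b p d q → (b + p) * d * (b * (d + q)) ≡ (b + p) * (d + q) * (b * d)
    swap = solve-∀
  sums : w + z ≡ u + v + p * q
  sums = +-cancelʳ-≡ (n + n) _ _ (begin
    w + z + (n + n)                   ≡⟨ pair w z n ⟩
    (w + n) + (z + n)                 ≡⟨ cong₂ _+_ hw hz ⟩
    (b + p) * (d + q) + b * d         ≡⟨ rectangle b p d q ⟩
    (b + p) * d + b * (d + q) + p * q ≡⟨ cong (_+ p * q) (cong₂ _+_ hu hv) ⟨
    (u + n) + (v + n) + p * q         ≡⟨ shuffle u v n (p * q) ⟨
    u + v + p * q + (n + n)           ∎)
    where
    pair : ∀ u v n → u + v + (n + n) ≡ (u + n) + (v + n)
    pair = solve-∀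
    shuffle : ∀ u v n s → u + v + s + (n + n) ≡ (u + n) + (v + n) + s
    shuffle = solve-∀
    rectangle : ∀ b p d q → (b + p) * (d + q) + b * d ≡ (b + p) * d + b * (d + q) + p * q
    rectangle = solve-∀

cross-product-lower-bound : ∀ {n b c d e u v} → n + n ≤ b → b ≤ c → c < d → d ≤ e →
  u + n ≡ c * d → v + n ≡ b * e → c * c * b * e ≤ u * v
cross-product-lower-bound {n} {b} {c} {d} {e} {u} {v} 2n≤b b≤c c<d d≤e hu hv =
  +-cancelˡ-≤ (n * (u + v + n)) _ _ (begin
    n * (u + v + n) + c * c * b * e ≤⟨ +-monoˡ-≤ (c * c * b * e) correction≤bce ⟩
    b * (c * e) + c * c * b * e     ≡⟨ regroup b c e ⟩
    c * suc c * (b * e)             ≤⟨ *-monoˡ-≤ (b * e) (*-monoʳ-≤ c c<d) ⟩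
    c * d * (b * e)                 ≡⟨ cong₂ _*_ hu hv ⟨
    (u + n) * (v + n)               ≡⟨ expand-shifted-product u v n ⟩
    n * (u + v + n) + u * v         ∎)
  where
  open ≤-Reasoning
  regroup : ∀ b c e → b * (c * e) + c * c * b * e ≡ c * suc c * (b * e)
  regroup = solve-∀
  correction≤bce : n * (u + v + n) ≤ b * (c * e)
  correction≤bce = begin
    n * (u + v + n)         ≤⟨ *-monoʳ-≤ n (m≤m+n (u + v + n) n) ⟩
    n * (u + v + n + n)     ≡⟨ cong (n *_) (shuffle u v n) ⟩
    n * ((u + n) + (v + n)) ≡⟨ cong (n *_) (cong₂ _+_ hu hv) ⟩
    n * (c * d + b * e)     ≤⟨ *-monoʳ-≤ n (+-mono-≤ (*-monoʳ-≤ c d≤e) (*-monoˡ-≤ e b≤c)) ⟩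
    n * (c * e + c * e)     ≡⟨ double n (c * e) ⟩
    (n + n) * (c * e)       ≤⟨ *-monoˡ-≤ (c * e) 2n≤b ⟩
    b * (c * e)             ∎
    where
    shuffle : ∀ u v n → u + v + n + n ≡ (u + n) + (v + n)
    shuffle = solve-∀
    double : ∀ n s → n * (s + s) ≡ (n + n) * s
    double = solve-∀

cross-power-bound : ∀ m {n b c d e} .{{_ : NonZero n}} →
  n + n ≤ b → b < c → c < d → d < e →
  IsPowerPlus (suc m) n (c * d) → IsPowerPlus (suc m) n (b * e) →
  IsPowerPlus (suc m) n (c * e) → IsPowerPlus (suc m) n (b * d) →
  (c * c * b * e) ^ m < (n * (c * e)) ^ suc m
cross-power-bound m {n} {b} {c} {d} {e} 2n≤b b<c c<d d<e (t₁ , hu) (s₂ , hv) (t₂ , hw) (s₁ , hz) =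
  begin-strict
    (c * c * b * e) ^ m ≤⟨ ^-monoˡ-≤ m (≤-trans lower-bound (≤-reflexive (sym (^-distrib-* t₁ s₂ k)))) ⟩
    (x ^ k) ^ m         ≡⟨ ^-comm-exponents x k m ⟩
    (x ^ m) ^ k         ≤⟨ ^-monoˡ-≤ k (^-pred≤difference {y = y} m xᵏ≡yᵏ+r r>0) ⟩
    r ^ k               <⟨ ^-monoˡ-< k r<nce ⟩
    (n * (c * e)) ^ k   ∎
  where
  open ≤-Reasoning
  k x y p q r : ℕ
  k = suc m
  x = t₁ * s₂
  y = t₂ * s₁
  p = c ∸ b
  q = e ∸ d
  r = n * (p * q)
  b+p≡c : b + p ≡ c
  b+p≡c = m+[n∸m]≡n (<⇒≤ b<c)
  d+q≡e : d + q ≡ e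
  d+q≡e = m+[n∸m]≡n (<⇒≤ d<e)
  xᵏ≡yᵏ+r : x ^ k ≡ y ^ k + r
  xᵏ≡yᵏ+r = begin-equality
    x ^ k                      ≡⟨ ^-distrib-* t₁ s₂ k ⟩
    t₁ ^ k * s₂ ^ k            ≡⟨ cross-difference {b = b} {p = p} {u = t₁ ^ k} {s₂ ^ k} {t₂ ^ k} {s₁ ^ k}
                                                   b+p≡c d+q≡e hu hv hw hz ⟩
    t₂ ^ k * s₁ ^ k + r        ≡⟨ cong (_+ r) (^-distrib-* t₂ s₁ k) ⟨
    y ^ k + r                  ∎
  r>0 : 0 < r
  r>0 = *-mono-≤ (>-nonZero⁻¹ n) (*-mono-≤ (m<n⇒0<n∸m b<c) (m<n⇒0<n∸m d<e))
  lower-bound : c * c * b * e ≤ t₁ ^ k * s₂ ^ k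
  lower-bound = cross-product-lower-bound {u = t₁ ^ k} {s₂ ^ k} 2n≤b (<⇒≤ b<c) c<d (<⇒≤ d<e)
                                          hu hv
  b>0 : 0 < b
  b>0 = <-≤-trans (>-nonZero⁻¹ n) (≤-trans (m≤m+n n n) 2n≤b)
  d>0 : 0 < d
  d>0 = ≤-trans (s≤s z≤n) c<d
  r<nce : r < n * (c * e)
  r<nce = *-monoʳ-< n (*-mono-< (subst (p <_) b+p≡c (m<n+m p b>0))
                                 (subst (q <_) d+q≡e (m<n+m q d>0)))

n^[3+j]≤c^[1+j] : ∀ j {n c} .{{_ : NonZero n}} → n ^ 3 ≤ c → n ^ (3 + j) ≤ c ^ (1 + j)
n^[3+j]≤c^[1+j] j {n} {c} n³≤c = begin
  n ^ (3 + j)       ≤⟨ ^-monoʳ-≤ n (≤-trans (m≤m+n (3 + j) (j + j)) (≤-reflexive (triple j))) ⟩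
  n ^ (3 * (1 + j)) ≡⟨ ^-*-assoc n 3 (1 + j) ⟨
  (n ^ 3) ^ (1 + j) ≤⟨ ^-monoˡ-≤ (1 + j) n³≤c ⟩
  c ^ (1 + j)       ∎
  where
  open ≤-Reasoning
  triple : ∀ j → 3 + j + (j + j) ≡ 3 * (1 + j)
  triple = solve-∀

cancel-common-factors : ∀ j {n b c e} .{{_ : NonZero n}} → n ^ 3 ≤ c →
  (c * c * b * e) ^ (2 + j) < (n * (c * e)) ^ (3 + j) → b ^ (2 + j) < e
cancel-common-factors j {n} {b} {c} {e} n³≤c bound =
  *-cancelˡ-< N _ _ (≤-<-trans (*-monoˡ-≤ B (n^[3+j]≤c^[1+j] j n³≤c)) c′B<Ne)
  where
  open ≡-Reasoning
  m B C E c′ N : ℕ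
  m = 2 + j
  B = b ^ m
  C = c ^ m
  E = e ^ m
  c′ = c ^ (1 + j)
  N = n ^ (3 + j)
  lhs : (c * c * b * e) ^ m ≡ C * E * (c * (c′ * B))
  lhs = begin
    (c * c * b * e) ^ m ≡⟨ ^-distrib-* (c * c * b) e m ⟩
    (c * c * b) ^ m * E ≡⟨ cong (_* E) (^-distrib-* (c * c) b m) ⟩
    (c * c) ^ m * B * E ≡⟨ cong (λ s → s * B * E) (^-distrib-* c c m) ⟩
    C * (c * c′) * B * E ≡⟨ regroup C c c′ B E ⟩
    C * E * (c * (c′ * B)) ∎
    where
    regroup : ∀ C c c′ B E → C * (c * c′) * B * E ≡ C * E * (c * (c′ * B))
    regroup = solve-∀
  rhs : (n * (c * e)) ^ (3 + j) ≡ C * E * (c * (N * e))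
  rhs = begin
    (n * (c * e)) ^ (3 + j)    ≡⟨ ^-distrib-* n (c * e) (3 + j) ⟩
    N * (c * e) ^ (3 + j)      ≡⟨ cong (N *_) (^-distrib-* c e (3 + j)) ⟩
    N * (c * C * (e * E))      ≡⟨ regroup N c C e E ⟩
    C * E * (c * (N * e))      ∎
    where
    regroup : ∀ N c C e E → N * (c * C * (e * E)) ≡ C * E * (c * (N * e))
    regroup = solve-∀
  c′B<Ne : c′ * B < N * e
  c′B<Ne = *-cancelˡ-< c _ _ (*-cancelˡ-< (C * E) _ _ (subst₂ _<_ lhs rhs bound))

n+n≤1+n³ : ∀ n → n + n ≤ suc (n ^ 3)
n+n≤1+n³ zero          = z≤n
n+n≤1+n³ (suc zero)    = ≤-refl
n+n≤1+n³ n@(suc (suc s)) = ≤-trans (≤-trans n+n≤n*n n*n≤n³) (n≤1+n (n ^ 3))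
  where
  n+n≤n*n : n + n ≤ n * n
  n+n≤n*n = +-monoʳ-≤ n (m≤n*m n (suc s))
  n*n≤n³ : n * n ≤ n ^ 3
  n*n≤n³ = *-monoʳ-≤ n (m≤m*n n (n * 1))

corollary2p9 : (k n a b c d e : ℕ) → 3 ≤ k → 1 ≤ n →
    n ^ 3 ≤ a → a < b → b < c → c < d → d < e →
    HasD k (- (+ n)) (a ∷ b ∷ c ∷ d ∷ e ∷ []) →
    b ^ (k ∸ 1) ≤ e
corollary2p9 k@(suc (suc (suc j))) n@(suc _) a b c d e
             (s≤s (s≤s (s≤s z≤n))) (s≤s z≤n) n³≤a a<b b<c c<d d<e D =
  <⇒≤ (cancel-common-factors j {n} n³≤c
        (cross-power-bound (2 + j) {n} 2n≤b b<c c<d d<e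
          (power c∈S d∈S (≤-trans n≤b (<⇒≤ b<c)) c<d)
          (power b∈S e∈S n≤b (<-trans b<c (<-trans c<d d<e)))
          (power c∈S e∈S (≤-trans n≤b (<⇒≤ b<c)) (<-trans c<d d<e))
          (power b∈S d∈S n≤b (<-trans b<c c<d))))
  where
  S : List ℕ
  S = a ∷ b ∷ c ∷ d ∷ e ∷ []
  power : ∀ {x y} → x ∈ S → y ∈ S → n ≤ x → x < y → IsPowerPlus k n (x * y)
  power = HasD⇒IsPowerPlus {k} D
  b∈S : b ∈ S
  b∈S = there (here refl)
  c∈S : c ∈ S
  c∈S = there (there (here refl))
  d∈S : d ∈ S
  d∈S = there (there (there (here refl)))
  e∈S : e ∈ S
  e∈S = there (there (there (there (here refl))))
  n³≤c : n ^ 3 ≤ c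
  n³≤c = ≤-trans n³≤a (<⇒≤ (<-trans a<b b<c))
  2n≤b : n + n ≤ b
  2n≤b = ≤-trans (n+n≤1+n³ n) (≤-trans (s≤s n³≤a) a<b)
  n≤b : n ≤ b
  n≤b = ≤-trans (m≤m+n n n) 2n≤b
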